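{- Let $\mathcal R$ and $\mathcal S$ be TRSs with $\mathcal R$ non-duplicating, and let $\mathcal A$ be a strongly linear matrix interpretation. Then $\mathcal R/\mathcal S$ and $\mathcal A$ admit a weight gap on the set of all terms.
   Context: A TRS is non-duplicating if for no rule $l\to r$ some variable occurs more often in $r$ than in $l$. A matrix interpretation $\mathcal A$ of dimension $k$ assigns to each $n$-ary symbol $f$ a map $f_{\mathcal A}(\vec v_1,\dots,\vec v_n)=F_1\vec v_1+\dots+F_n\vec v_n+\vec f$ with $F_i\in\mathbb N^{k\times k}$, $\vec f\in\mathbb N^k$; it is strongly linear (SLMI) if every $F_i$ is the $k\times k$ identity matrix, i.e. $f_{\mathcal A}(\vec v_1,\dots,\vec v_n)=\vec v_1+\dots+\vec v_n+\vec f$. $[t]$ is the evaluation of $t$ with all variables mapped to $\vec0$, $[t]_1$ its first component. For a set $T$ of terms, a weight gap on $T$ (for $\mathcal R/\mathcal S$ and $\mathcal A$) is $\Delta\in\mathbb N$ such that whenever $s_0\to^*_{\mathcal R\cup\mathcal S}s$ for some $s_0\in T$ and $s\to_{\mathcal R}t$, then $[t]_1-[s]_1\le\Delta$. -}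

module Defs where

open import Data.Nat using (ℕ; zero; suc; _+_; _*_; _≤_; _<_)
open import Data.Nat.Properties using (_≟_)
open import Data.Fin using (Fin; zero; suc)
open import Data.List using (List; _++_)
open import Data.List.Membership.Propositional using (_∈_)
open import Data.Product using (Σ; ∃; ∃-syntax; _×_; _,_)
open import Relation.Binary.PropositionalEquality using (_≡_)
open import Relation.Nullary using (¬_; yes; no)
open import Relation.Binary.Construct.Closure.ReflexiveTransitive using (Star)

sumFin : (n : ℕ) → (Fin n → ℕ) → ℕ
sumFin zero    g = 0
sumFin (suc n) g = g zero + sumFin n (λ i → g (suc i))

record Signature : Set₁ where
  field
    Symbol : Set
    arity  : Symbol → ℕ

module _ (Sig : Signature) where
  open Signature Sig

  data Term : Set where
    var : ℕ → Term
    fun : (f : Symbol) → (Fin (arity f) → Term) → Term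

  occ : ℕ → Term → ℕ
  occ x (var y) with x ≟ y
  ... | yes _ = 1
  ... | no  _ = 0
  occ x (fun f ts) = sumFin (arity f) (λ i → occ x (ts i))

  Subst : Set
  Subst = ℕ → Term

  _⟨_⟩ : Term → Subst → Term
  var x ⟨ σ ⟩ = σ x
  fun f ts ⟨ σ ⟩ = fun f (λ i → ts i ⟨ σ ⟩)

  Rule : Set
  Rule = Term × Term

  TRS : Set
  TRS = List Rule

  IsTRS : TRS → Set
  IsTRS R = ∀ {l r} → (l , r) ∈ R →
    (∀ x → ¬ (l ≡ var x)) × (∀ x → 0 < occ x r → 0 < occ x l)

  NonDuplicating : TRS → Set
  NonDuplicating R = ∀ {l r} → (l , r) ∈ R → ∀ x → occ x r ≤ occ x l

  data Step (R : TRS) : Term → Term → Set where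
    root : ∀ {l r} → (l , r) ∈ R → (σ : Subst) → Step R (l ⟨ σ ⟩) (r ⟨ σ ⟩)
    cong : ∀ f (us vs : Fin (arity f) → Term) (i : Fin (arity f)) →
           Step R (us i) (vs i) → (∀ j → ¬ (j ≡ i) → us j ≡ vs j) →
           Step R (fun f us) (fun f vs)

  Steps : TRS → Term → Term → Set
  Steps R = Star (Step R)

  Vect : ℕ → Set
  Vect k = Fin k → ℕ

  Mat : ℕ → Set
  Mat k = Fin k → Fin k → ℕ

  _·_ : ∀ {k} → Mat k → Vect k → Vect k
  _·_ {k} M v a = sumFin k (λ b → M a b * v b)

  idMat : ∀ {k} → Mat k
  idMat a b with a Data.Fin.≟ b
  ... | yes _ = 1
  ... | no  _ = 0

  -- matrix interpretation of dimension k: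
  --   f(v₁,…,vₙ) = F₁v₁ + … + Fₙvₙ + f⃗
  record MatrixInterpretation (k : ℕ) : Set where
    field
      coeff : (f : Symbol) → Fin (arity f) → Mat k
      const : Symbol → Vect k

  StronglyLinear : ∀ {k} → MatrixInterpretation k → Set
  StronglyLinear A = ∀ f i a b → MatrixInterpretation.coeff A f i a b ≡ idMat a b

  ⟦_⟧ : ∀ {k} → MatrixInterpretation k → Term → Vect k
  ⟦ A ⟧ (var x) a = 0
  ⟦_⟧ {k} A (fun f ts) a =
    sumFin (arity f) (λ i → (MatrixInterpretation.coeff A f i · ⟦ A ⟧ (ts i)) a)
      + MatrixInterpretation.const A f a

  -- Δ is a weight gap on T for R/S and A (first component = index zero)
  WeightGap : (R S : TRS) → ∀ {k} → MatrixInterpretation (suc k) →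
              (Term → Set) → ℕ → Set
  WeightGap R S A T Δ = ∀ s₀ s t → T s₀ → Steps (R ++ S) s₀ s → Step R s t →
                        ⟦ A ⟧ t zero ≤ ⟦ A ⟧ s zero + Δ

-- Under a strongly linear interpretation every component of [_] is additive,
-- [f(t₁,…,tₙ)] = Σᵢ [tᵢ] + f⃗, hence [tσ] = [t] + Σₓ occ(x,t)·[σx]. For a root
-- step lσ → rσ the substitution part can only shrink, as no variable occurs
-- more often in r than in l, so the weight grows by at most [r]; additivity
-- carries this bound through every context. The largest weight of a
-- right-hand side is therefore a gap for every R-step, reachable or not.
module Submission where

open import Defs hiding (cong)
import Defs
open import Data.Nat using (ℕ; zero; suc; _+_; _*_; _≤_; z≤n)
open import Data.Nat.Properties
open import Algebra.Properties.CommutativeSemigroup +-commutativeSemigroup using (xy∙z≈xz∙y)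
open import Algebra.Properties.Semiring.Sum +-*-semiring
  using (sum; sum-remove; sum-cong-≗; sum-replicate-zero; ∑-distrib-+; ∑-comm; *-distribʳ-sum)
open import Data.Fin using (Fin; zero; suc; toℕ; fromℕ<; punchIn)
import Data.Fin as Fin
open import Data.Fin.Properties using (toℕ-injective; toℕ-fromℕ<; punchInᵢ≢i)
open import Data.List using (map)
open import Data.List.Extrema.Nat using (max; xs≤max)
open import Data.List.Membership.Propositional using (_∈_)
open import Data.List.Relation.Unary.All using (lookup)
open import Data.List.Relation.Unary.All.Properties using (map⁻)
open import Data.Product using (∃; _,_; proj₂)
open import Data.Unit using (⊤)
open import Data.Vec.Functional using (Vector; removeAt)
open import Function using (_∘_)
open import Relation.Binary.PropositionalEquality
  using (_≡_; _≢_; _≗_; refl; sym; trans; cong; subst; module ≡-Reasoning)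
open import Relation.Nullary using (yes; no; contradiction)

sumFin≡sum : ∀ n (g : Vector ℕ n) → sumFin n g ≡ sum g
sumFin≡sum zero    g = refl
sumFin≡sum (suc n) g = cong (g zero +_) (sumFin≡sum n (g ∘ suc))

sum-mono-≤ : ∀ {n} {f g : Vector ℕ n} → (∀ i → f i ≤ g i) → sum f ≤ sum g
sum-mono-≤ {zero}  f≤g = z≤n
sum-mono-≤ {suc n} f≤g = +-mono-≤ (f≤g zero) (sum-mono-≤ (f≤g ∘ suc))

≤-sum : ∀ {n} (f : Vector ℕ n) i → f i ≤ sum f
≤-sum {suc n} f i = subst (f i ≤_) (sym (sum-remove {i = i} f)) (m≤m+n _ _)

removeAt-cong : ∀ {n} {f g : Vector ℕ (suc n)} i →
                (∀ j → j ≢ i → f j ≡ g j) → removeAt f i ≗ removeAt g i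
removeAt-cong i f≡g j = f≡g (punchIn i j) (punchInᵢ≢i i j)

sum-select : ∀ {n} (f : Vector ℕ n) i → (∀ j → j ≢ i → f j ≡ 0) → sum f ≡ f i
sum-select {suc n} f i f≡0 = begin
  sum f                     ≡⟨ sum-remove {i = i} f ⟩
  f i + sum (removeAt f i)  ≡⟨ cong (f i +_) (sum-cong-≗ (removeAt-cong {g = λ _ → 0} i f≡0)) ⟩
  f i + sum {n} (λ _ → 0)   ≡⟨ cong (f i +_) (sum-replicate-zero n) ⟩
  f i + 0                   ≡⟨ +-identityʳ (f i) ⟩
  f i                       ∎
  where open ≡-Reasoning

sum-≤-update : ∀ {n} {f g : Vector ℕ n} i {Δ} →
               g i ≤ f i + Δ → (∀ j → j ≢ i → g j ≡ f j) → sum g ≤ sum f + Δ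
sum-≤-update {suc n} {f} {g} i {Δ} gᵢ≤fᵢ+Δ g≡f = begin
  sum g                         ≡⟨ sum-remove {i = i} g ⟩
  g i + sum (removeAt g i)      ≡⟨ cong (g i +_) (sum-cong-≗ (removeAt-cong i g≡f)) ⟩
  g i + sum (removeAt f i)      ≤⟨ +-monoˡ-≤ _ gᵢ≤fᵢ+Δ ⟩
  f i + Δ + sum (removeAt f i)  ≡⟨ xy∙z≈xz∙y (f i) Δ _ ⟩
  f i + sum (removeAt f i) + Δ  ≡⟨ cong (_+ Δ) (sum-remove {i = i} f) ⟨
  sum f + Δ                     ∎
  where open ≤-Reasoning

module _ (Sig : Signature) where
  open Signature Sig

  occ-var-self : ∀ x → occ Sig x (var x) ≡ 1
  occ-var-self x with x ≟ x
  ... | yes _   = refl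
  ... | no x≢x = contradiction refl x≢x

  occ-var-other : ∀ {x y} → x ≢ y → occ Sig x (var y) ≡ 0
  occ-var-other {x} {y} x≢y with x ≟ y
  ... | yes x≡y = contradiction x≡y x≢y
  ... | no _    = refl

  occWeight : (ℕ → ℕ) → Term Sig → ℕ
  occWeight c (var x)    = c x
  occWeight c (fun f ts) = sum (λ i → occWeight c (ts i))

  varBound : Term Sig → ℕ
  varBound (var x)    = suc x
  varBound (fun f ts) = sum (λ i → varBound (ts i))

  occWeight≡∑occ : ∀ c t {N} → varBound t ≤ N →
                   occWeight c t ≡ sum (λ (x : Fin N) → occ Sig (toℕ x) t * c (toℕ x))
  occWeight≡∑occ c (var y) y<N = sym (begin
    sum f                    ≡⟨ sum-select f (fromℕ< y<N) f≡0 ⟩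
    f (fromℕ< y<N)           ≡⟨ cong (λ z → occ Sig z (var y) * c z) (toℕ-fromℕ< y<N) ⟩
    occ Sig y (var y) * c y  ≡⟨ cong (_* c y) (occ-var-self y) ⟩
    1 * c y                  ≡⟨ *-identityˡ (c y) ⟩
    c y                      ∎)
    where
    open ≡-Reasoning
    f = λ x → occ Sig (toℕ x) (var y) * c (toℕ x)
    f≡0 : ∀ x → x ≢ fromℕ< y<N → f x ≡ 0
    f≡0 x x≢y = cong (_* c (toℕ x)) (occ-var-other λ x≡y →
      x≢y (toℕ-injective (trans x≡y (sym (toℕ-fromℕ< y<N)))))
  occWeight≡∑occ c (fun f ts) {N} bound = begin
    sum (λ i → occWeight c (ts i))
      ≡⟨ sum-cong-≗ (λ i → occWeight≡∑occ c (ts i) (≤-trans (≤-sum _ i) bound)) ⟩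
    sum (λ i → sum (λ (x : Fin N) → occ Sig (toℕ x) (ts i) * c (toℕ x)))
      ≡⟨ ∑-comm (λ i (x : Fin N) → occ Sig (toℕ x) (ts i) * c (toℕ x)) ⟩
    sum (λ (x : Fin N) → sum (λ i → occ Sig (toℕ x) (ts i) * c (toℕ x)))
      ≡⟨ sum-cong-≗ {N} (λ x → *-distribʳ-sum (c (toℕ x)) (λ i → occ Sig (toℕ x) (ts i))) ⟨
    sum (λ (x : Fin N) → sum (λ i → occ Sig (toℕ x) (ts i)) * c (toℕ x))
      ≡⟨ sum-cong-≗ {N} (λ x → cong (_* c (toℕ x)) (sumFin≡sum (arity f) (λ i → occ Sig (toℕ x) (ts i)))) ⟨
    sum (λ (x : Fin N) → occ Sig (toℕ x) (fun f ts) * c (toℕ x))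
      ∎
    where open ≡-Reasoning

  occWeight-mono : ∀ c {l r} → (∀ x → occ Sig x r ≤ occ Sig x l) →
                   occWeight c r ≤ occWeight c l
  occWeight-mono c {l} {r} r≤l = begin
    occWeight c r
      ≡⟨ occWeight≡∑occ c r {N} (m≤n+m _ _) ⟩
    sum (λ (x : Fin N) → occ Sig (toℕ x) r * c (toℕ x))
      ≤⟨ sum-mono-≤ {N} (λ x → *-monoˡ-≤ (c (toℕ x)) (r≤l (toℕ x))) ⟩
    sum (λ (x : Fin N) → occ Sig (toℕ x) l * c (toℕ x))
      ≡⟨ occWeight≡∑occ c l {N} (m≤m+n _ _) ⟨
    occWeight c l
      ∎
    where
    open ≤-Reasoning
    N = varBound l + varBound r

  idMat-diag : ∀ {k} (a : Fin k) → idMat Sig a a ≡ 1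
  idMat-diag a with a Fin.≟ a
  ... | yes _   = refl
  ... | no a≢a = contradiction refl a≢a

  idMat-off : ∀ {k} {a b : Fin k} → b ≢ a → idMat Sig a b ≡ 0
  idMat-off {a = a} {b} b≢a with a Fin.≟ b
  ... | yes a≡b = contradiction (sym a≡b) b≢a
  ... | no _    = refl

  ·-identity : ∀ {k} (M : Mat Sig k) → (∀ a b → M a b ≡ idMat Sig a b) →
               ∀ v a → _·_ Sig M v a ≡ v a
  ·-identity {k} M M≡I v a = begin
    sumFin k (λ b → M a b * v b)  ≡⟨ sumFin≡sum k _ ⟩
    sum (λ b → M a b * v b)       ≡⟨ sum-select _ a off-diagonal ⟩
    M a a * v a                   ≡⟨ cong (_* v a) (trans (M≡I a a) (idMat-diag a)) ⟩
    1 * v a                       ≡⟨ *-identityˡ (v a) ⟩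
    v a                           ∎
    where
    open ≡-Reasoning
    off-diagonal : ∀ b → b ≢ a → M a b * v b ≡ 0
    off-diagonal b b≢a = cong (_* v b) (trans (M≡I a b) (idMat-off b≢a))

  module _ {k} (A : MatrixInterpretation Sig k) (SL : StronglyLinear Sig A) where
    open MatrixInterpretation A

    [_] : Term Sig → Vect Sig k
    [_] = ⟦_⟧ Sig A

    [fun] : ∀ f ts a → [ fun f ts ] a ≡ sum (λ i → [ ts i ] a) + const f a
    [fun] f ts a = cong (_+ const f a) (trans (sumFin≡sum (arity f) _)
      (sum-cong-≗ (λ i → ·-identity (coeff f i) (SL f i) [ ts i ] a)))

    [⟨⟩] : ∀ t σ a → [ _⟨_⟩ Sig t σ ] a ≡ [ t ] a + occWeight (λ x → [ σ x ] a) t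
    [⟨⟩] (var x)    σ a = refl
    [⟨⟩] (fun f ts) σ a = begin
      [ fun f (λ i → _⟨_⟩ Sig (ts i) σ) ] a
        ≡⟨ [fun] f (λ i → _⟨_⟩ Sig (ts i) σ) a ⟩
      sum (λ i → [ _⟨_⟩ Sig (ts i) σ ] a) + const f a
        ≡⟨ cong (_+ const f a) (sum-cong-≗ (λ i → [⟨⟩] (ts i) σ a)) ⟩
      sum (λ i → [ ts i ] a + W (ts i)) + const f a
        ≡⟨ cong (_+ const f a) (∑-distrib-+ (λ i → [ ts i ] a) (λ i → W (ts i))) ⟩
      sum (λ i → [ ts i ] a) + sum (λ i → W (ts i)) + const f a
        ≡⟨ xy∙z≈xz∙y (sum (λ i → [ ts i ] a)) (sum (λ i → W (ts i))) (const f a) ⟩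
      sum (λ i → [ ts i ] a) + const f a + sum (λ i → W (ts i))
        ≡⟨ cong (_+ sum (λ i → W (ts i))) ([fun] f ts a) ⟨
      [ fun f ts ] a + W (fun f ts)
        ∎
      where
      open ≡-Reasoning
      W = occWeight (λ x → [ σ x ] a)

    maxRhsWeight : Fin k → TRS Sig → ℕ
    maxRhsWeight a R = max 0 (map (λ rule → [ proj₂ rule ] a) R)

    rhs≤maxRhsWeight : ∀ a R {l r} → (l , r) ∈ R → [ r ] a ≤ maxRhsWeight a R
    rhs≤maxRhsWeight a R = lookup (map⁻ (xs≤max 0 (map (λ rule → [ proj₂ rule ] a) R)))

    step-weight-≤ : ∀ a R → NonDuplicating Sig R → ∀ {s t} → Step Sig R s t →
                    [ t ] a ≤ [ s ] a + maxRhsWeight a R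
    step-weight-≤ a R nonDup (root {l} {r} l→r σ) = begin
      [ _⟨_⟩ Sig r σ ] a
        ≡⟨ [⟨⟩] r σ a ⟩
      [ r ] a + W r
        ≤⟨ +-mono-≤ (rhs≤maxRhsWeight a R l→r) (occWeight-mono _ {l} {r} (nonDup l→r)) ⟩
      Δ + W l
        ≤⟨ +-monoʳ-≤ Δ (m≤n+m (W l) ([ l ] a)) ⟩
      Δ + ([ l ] a + W l)
        ≡⟨ +-comm Δ _ ⟩
      [ l ] a + W l + Δ
        ≡⟨ cong (_+ Δ) ([⟨⟩] l σ a) ⟨
      [ _⟨_⟩ Sig l σ ] a + Δ
        ∎
      where
      open ≤-Reasoning
      W = occWeight (λ x → [ σ x ] a)
      Δ = maxRhsWeight a R
    step-weight-≤ a R nonDup (Defs.cong f us vs i uᵢ→vᵢ us≡vs) = begin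
      [ fun f vs ] a
        ≡⟨ [fun] f vs a ⟩
      sum (λ j → [ vs j ] a) + const f a
        ≤⟨ +-monoˡ-≤ (const f a) sum-vs≤sum-us+Δ ⟩
      sum (λ j → [ us j ] a) + Δ + const f a
        ≡⟨ xy∙z≈xz∙y (sum (λ j → [ us j ] a)) Δ (const f a) ⟩
      sum (λ j → [ us j ] a) + const f a + Δ
        ≡⟨ cong (_+ Δ) ([fun] f us a) ⟨
      [ fun f us ] a + Δ
        ∎
      where
      open ≤-Reasoning
      Δ = maxRhsWeight a R
      sum-vs≤sum-us+Δ : sum (λ j → [ vs j ] a) ≤ sum (λ j → [ us j ] a) + Δ
      sum-vs≤sum-us+Δ = sum-≤-update i (step-weight-≤ a R nonDup uᵢ→vᵢ)
        (λ j j≢i → cong (λ u → [ u ] a) (sym (us≡vs j j≢i)))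

lemma45 : (Sig : Signature) (R S : TRS Sig) → IsTRS Sig R → IsTRS Sig S →
          NonDuplicating Sig R →
          (k : ℕ) (A : MatrixInterpretation Sig (suc k)) → StronglyLinear Sig A →
          ∃ λ (Δ : ℕ) → WeightGap Sig R S A (λ _ → ⊤) Δ
lemma45 Sig R S _ _ nonDup k A SL =
  maxRhsWeight Sig A SL zero R , λ _ _ _ _ _ s→t → step-weight-≤ Sig A SL zero R nonDup s→t
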